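{- If $\varphi$ is a partial edge coloring of $Q_d$ with colors from $\{1,\dots,d\}$ that uses at most three distinct colors, and every color appears on at most $d-2$ edges, then $\varphi$ is avoidable.
   Context: $Q_d$ is the $d$-dimensional hypercube. A partial edge coloring assigns colors to some subset of edges (not necessarily properly); it is avoidable if there is a proper $d$-edge coloring $f$ of $Q_d$ with colors $1,\dots,d$ such that $f(e)\neq\varphi(e)$ for every colored edge $e$. -}

module Defs where

open import Data.Nat using (ℕ; _≤_; _∸_)
open import Data.Fin using (Fin)
open import Data.Bool using (Bool; true; false; not)
open import Data.Vec using (Vec; lookup; updateAt)
open import Data.Maybe using (Maybe; just)
open import Data.List using (List; length)
open import Data.List.Membership.Propositional using (_∈_)
open import Data.List.Relation.Unary.All using (All)
open import Data.List.Relation.Unary.Unique.Propositional using (Unique)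
open import Data.Product using (Σ; ∃; _×_)
open import Data.Sum using (_⊎_)
open import Relation.Binary.PropositionalEquality using (_≡_; _≢_)

Vertex : ℕ → Set
Vertex d = Vec Bool d

flip : ∀ {d} → Vertex d → Fin d → Vertex d
flip v i = updateAt v i not

-- An edge of Q_d: represented uniquely by its lower endpoint v
-- (with v_i = false) and its direction i; it joins v and flip v i.
record Edge (d : ℕ) : Set where
  constructor edge
  field
    low    : Vertex d
    dir    : Fin d
    low-i  : lookup low dir ≡ false
open Edge public

high : ∀ {d} → Edge d → Vertex d
high e = flip (low e) (dir e)

_∈ₑ_ : ∀ {d} → Vertex d → Edge d → Set
x ∈ₑ e = x ≡ low e ⊎ x ≡ high e

-- Colors 1..d are represented by Fin d.
Color : ℕ → Set
Color d = Fin d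

PartialColoring : ℕ → Set
PartialColoring d = Edge d → Maybe (Color d)

Proper : ∀ {d} → (Edge d → Color d) → Set
Proper {d} f = ∀ (e₁ e₂ : Edge d) (x : Vertex d) →
  e₁ ≢ e₂ → x ∈ₑ e₁ → x ∈ₑ e₂ → f e₁ ≢ f e₂

Avoidable : ∀ {d} → PartialColoring d → Set
Avoidable {d} φ = Σ (Edge d → Color d) λ f →
  Proper f × (∀ (e : Edge d) (c : Color d) → φ e ≡ just c → f e ≢ c)

UsesAtMostColors : ∀ {d} → ℕ → PartialColoring d → Set
UsesAtMostColors {d} k φ = Σ (List (Color d)) λ cs →
  length cs ≤ k × (∀ (e : Edge d) (c : Color d) → φ e ≡ just c → c ∈ cs)

ColorOnAtMost : ∀ {d} → ℕ → PartialColoring d → Color d → Set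
ColorOnAtMost {d} m φ c = ∀ (es : List (Edge d)) → Unique es →
  All (λ e → φ e ≡ just c) es → length es ≤ m

-- Colouring every edge of direction j by π j, for an injection π of directions into colours,
-- is proper, and it avoids φ as soon as each colour c used by φ is sent to a direction in which
-- c does not occur. A colour used at most d - 2 times is free in at least two directions, so
-- (padding the colours to three distinct ones) such a π exists unless one colour c₃ is free in
-- exactly two directions a, b, in both of which the other two colours are free as well. Then c₃
-- occurs exactly once in every other direction k, and we colour a, b, k by c₁, c₂, c₃ and
-- exchange the colours of a and k on the square spanned by a and k through the c₃-edge of
-- direction k; the colour of the edge opposite to it in that square decides whether c₁ and c₂
-- must trade places first.

module Submission where

open import Defs
open import Data.Nat using (ℕ; zero; suc; _≤_; _∸_; s≤s)
open import Data.Nat.Properties using (1+n≰n)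
open import Data.Fin using (Fin; zero; suc; punchIn; punchOut)
open import Data.Fin.Properties using (_≟_; any?; punchIn-injective; punchInᵢ≢i; punchIn-punchOut)
open import Data.Fin.Permutation.Components using (transpose; transpose-inverse)
open import Data.Bool using (Bool; true; false; not)
open import Data.Bool.Properties using (not-involutive; ¬-not) renaming (_≟_ to _≟ᵇ_)
open import Data.Vec using (Vec; []; _∷_; lookup; _[_]≔_)
open import Data.Vec.Properties
  using (lookup∘updateAt; lookup∘updateAt′; updateAt-updateAt; updateAt-id-local; updateAt-commutes)
import Data.Vec.Properties as Vec
open import Data.Vec.Relation.Binary.Pointwise.Extensional using (ext; Pointwise-≡⇒≡)
open import Data.Maybe using (just)
import Data.Maybe.Properties as Maybe
open import Data.List using (List; []; _∷_; length; tabulate)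
open import Data.List.Properties using (length-tabulate)
open import Data.List.Membership.Propositional using (_∈_)
open import Data.List.Relation.Unary.Any using (here; there)
open import Data.List.Relation.Unary.All using ([]; _∷_)
import Data.List.Relation.Unary.All.Properties as All
open import Data.List.Relation.Unary.AllPairs using ([]; _∷_)
import Data.List.Relation.Unary.Unique.Propositional.Properties as Unique
open import Data.Product using (Σ; ∃; _×_; _,_; proj₁; proj₂)
open import Data.Sum using (_⊎_; inj₁; inj₂; [_,_]′)
open import Function.Base using (_∘_; id; const; case_of_)
open import Function.Definitions using (Injective)
open import Relation.Unary using (Pred; Decidable; _⊆_)
open import Relation.Nullary.Decidable using (Dec; yes; no; map′; _×-dec_; _⊎-dec_; ¬?; decidable-stable)
open import Relation.Nullary.Negation using (¬_; contradiction)
open import Relation.Binary.Definitions using (DecidableEquality)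
open import Relation.Binary.PropositionalEquality
open import Axiom.UniquenessOfIdentityProofs using (module Decidable⇒UIP)

-- Geometry of the cube

module _ {d : ℕ} where

  lookup-high-dir : (e : Edge d) → lookup (high e) (dir e) ≡ true
  lookup-high-dir e = trans (lookup∘updateAt (dir e) (low e)) (cong not (low-i e))

  flip-involutive : (v : Vertex d) (i : Fin d) → flip (flip v i) i ≡ v
  flip-involutive v i = trans (updateAt-updateAt i v) (updateAt-id-local i v (not-involutive _))

  lookup-flip-other : (v : Vertex d) {i j : Fin d} → j ≢ i → lookup (flip v i) j ≡ lookup v j
  lookup-flip-other v {i} {j} j≢i = lookup∘updateAt′ j i j≢i v

  edge-≡ : {e₁ e₂ : Edge d} → low e₁ ≡ low e₂ → dir e₁ ≡ dir e₂ → e₁ ≡ e₂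
  edge-≡ {edge v i p} {edge _ _ q} refl refl = cong (edge v i) (Decidable⇒UIP.≡-irrelevant _≟ᵇ_ p q)

  _≟ₑ_ : DecidableEquality (Edge d)
  e₁ ≟ₑ e₂ = map′ (λ (p , q) → edge-≡ p q) (λ { refl → refl , refl })
    (Vec.≡-dec _≟ᵇ_ (low e₁) (low e₂) ×-dec (dir e₁ ≟ dir e₂))

  shift : (e : Edge d) (i : Fin d) → dir e ≢ i → Edge d
  shift e i dir≢i = edge (flip (low e) i) (dir e) (trans (lookup-flip-other (low e) dir≢i) (low-i e))

  low≢high : (e₁ e₂ : Edge d) → dir e₁ ≡ dir e₂ → low e₁ ≢ high e₂
  low≢high e₁ e₂ dir≡ eq
    with () ← trans (sym (low-i e₁)) (trans (cong₂ lookup eq dir≡) (lookup-high-dir e₂))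

  low-unique : (e₁ e₂ : Edge d) {x : Vertex d} →
    dir e₁ ≡ dir e₂ → x ∈ₑ e₁ → x ∈ₑ e₂ → low e₁ ≡ low e₂
  low-unique e₁ e₂ dir≡ (inj₁ p) (inj₁ q) = trans (sym p) q
  low-unique e₁ e₂ dir≡ (inj₁ p) (inj₂ q) = contradiction (trans (sym p) q) (low≢high e₁ e₂ dir≡)
  low-unique e₁ e₂ dir≡ (inj₂ p) (inj₁ q) = contradiction (trans (sym q) p) (low≢high e₂ e₁ (sym dir≡))
  low-unique e₁ e₂ dir≡ (inj₂ p) (inj₂ q) = begin
    low e₁                         ≡⟨ flip-involutive (low e₁) (dir e₁) ⟨
    flip (high e₁) (dir e₁)        ≡⟨ cong₂ flip (trans (sym p) q) dir≡ ⟩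
    flip (high e₂) (dir e₂)        ≡⟨ flip-involutive (low e₂) (dir e₂) ⟩
    low e₂                         ∎
    where open ≡-Reasoning

  -- σ v is the colouring of directions seen from v; the flip condition says that both
  -- endpoints of an edge see the same colour.
  proper-from-local-injections : (σ : Vertex d → Fin d → Color d) →
    (∀ v → Injective _≡_ _≡_ (σ v)) → (∀ v i → σ (flip v i) i ≡ σ v i) →
    Proper (λ e → σ (low e) (dir e))
  proper-from-local-injections σ σ-injective σ-flip e₁ e₂ x e₁≢e₂ x∈e₁ x∈e₂ same =
    e₁≢e₂ (edge-≡ (low-unique e₁ e₂ dir≡ x∈e₁ x∈e₂) dir≡)
    where
    seen-from-x : (e : Edge d) → x ∈ₑ e → σ x (dir e) ≡ σ (low e) (dir e)
    seen-from-x e (inj₁ refl) = refl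
    seen-from-x e (inj₂ refl) = σ-flip (low e) (dir e)
    dir≡ : dir e₁ ≡ dir e₂
    dir≡ = σ-injective x (trans (seen-from-x e₁ x∈e₁) (trans same (sym (seen-from-x e₂ x∈e₂))))

module _ {n : ℕ} (i j : Fin n) where

  transpose-injective : Injective _≡_ _≡_ (transpose i j)
  transpose-injective {x} {y} eq = begin
    x                                 ≡⟨ transpose-inverse j i ⟨
    transpose j i (transpose i j x)   ≡⟨ cong (transpose j i) eq ⟩
    transpose j i (transpose i j y)   ≡⟨ transpose-inverse j i ⟩
    y                                 ∎
    where open ≡-Reasoning

  transpose-matchˡ : transpose i j i ≡ j
  transpose-matchˡ with i ≟ i
  ... | yes _   = refl
  ... | no i≢i = contradiction refl i≢i

  transpose-matchʳ : transpose i j j ≡ i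
  transpose-matchʳ with j ≟ i
  ... | yes j≡i = j≡i
  ... | no _ with j ≟ j
  ...   | yes _   = refl
  ...   | no j≢j = contradiction refl j≢j

  transpose-fix : ∀ {k} → k ≢ i → k ≢ j → transpose i j k ≡ k
  transpose-fix {k} k≢i k≢j with k ≟ i
  ... | yes k≡i = contradiction k≡i k≢i
  ... | no _ with k ≟ j
  ...   | yes k≡j = contradiction k≡j k≢j
  ...   | no _    = refl

module _ {n : ℕ} (τ : Fin n → Fin n) (τ-injective : Injective _≡_ _≡_ τ) (a c : Fin n) where

  retarget : Fin n → Fin n
  retarget = transpose (τ a) c ∘ τ

  retarget-injective : Injective _≡_ _≡_ retarget
  retarget-injective = τ-injective ∘ transpose-injective (τ a) c

  retarget-at : retarget a ≡ c
  retarget-at = transpose-matchˡ (τ a) c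

  retarget-elsewhere : ∀ {x} → x ≢ a → τ x ≢ c → retarget x ≡ τ x
  retarget-elsewhere x≢a τx≢c = transpose-fix (τ a) c (x≢a ∘ τ-injective) τx≢c

injection₃ : ∀ {n} {a₁ a₂ a₃ c₁ c₂ c₃ : Fin n} →
  a₁ ≢ a₂ → a₁ ≢ a₃ → a₂ ≢ a₃ → c₁ ≢ c₂ → c₁ ≢ c₃ → c₂ ≢ c₃ →
  Σ (Fin n → Fin n) λ π → Injective _≡_ _≡_ π × π a₁ ≡ c₁ × π a₂ ≡ c₂ × π a₃ ≡ c₃
injection₃ {n} {a₁} {a₂} {a₃} {c₁} {c₂} {c₃} a₁≢a₂ a₁≢a₃ a₂≢a₃ c₁≢c₂ c₁≢c₃ c₂≢c₃ =
  π₃ , π₃-injective , π₃a₁ , π₃a₂ , π₃a₃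
  where
  π₁ : Fin n → Fin n
  π₁ = retarget id id a₁ c₁
  π₁-injective : Injective _≡_ _≡_ π₁
  π₁-injective = retarget-injective id id a₁ c₁
  π₁a₁ : π₁ a₁ ≡ c₁
  π₁a₁ = retarget-at id id a₁ c₁

  π₂ : Fin n → Fin n
  π₂ = retarget π₁ π₁-injective a₂ c₂
  π₂-injective : Injective _≡_ _≡_ π₂
  π₂-injective = retarget-injective π₁ π₁-injective a₂ c₂
  π₂a₂ : π₂ a₂ ≡ c₂
  π₂a₂ = retarget-at π₁ π₁-injective a₂ c₂
  π₂a₁ : π₂ a₁ ≡ c₁
  π₂a₁ = trans (retarget-elsewhere π₁ π₁-injective a₂ c₂ a₁≢a₂ (c₁≢c₂ ∘ trans (sym π₁a₁))) π₁a₁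

  π₃ : Fin n → Fin n
  π₃ = retarget π₂ π₂-injective a₃ c₃
  π₃-injective : Injective _≡_ _≡_ π₃
  π₃-injective = retarget-injective π₂ π₂-injective a₃ c₃
  π₃a₃ : π₃ a₃ ≡ c₃
  π₃a₃ = retarget-at π₂ π₂-injective a₃ c₃
  π₃a₂ : π₃ a₂ ≡ c₂
  π₃a₂ = trans (retarget-elsewhere π₂ π₂-injective a₃ c₃ a₂≢a₃ (c₂≢c₃ ∘ trans (sym π₂a₂))) π₂a₂
  π₃a₁ : π₃ a₁ ≡ c₁
  π₃a₁ = trans (retarget-elsewhere π₂ π₂-injective a₃ c₃ a₁≢a₃ (c₁≢c₃ ∘ trans (sym π₂a₁))) π₂a₁

module _ {n : ℕ} {a b : Fin (suc (suc n))} (a≢b : a ≢ b) where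

  punchIn₂ : Fin n → Fin (suc (suc n))
  punchIn₂ i = punchIn a (punchIn (punchOut a≢b) i)

  punchIn₂≢ˡ : ∀ i → punchIn₂ i ≢ a
  punchIn₂≢ˡ i = punchInᵢ≢i a _

  punchIn₂≢ʳ : ∀ i → punchIn₂ i ≢ b
  punchIn₂≢ʳ i eq = punchInᵢ≢i (punchOut a≢b) i
    (punchIn-injective a _ _ (trans eq (sym (punchIn-punchOut a≢b))))

  punchIn₂-injective : Injective _≡_ _≡_ punchIn₂
  punchIn₂-injective {i} {j} = punchIn-injective (punchOut a≢b) i j ∘ punchIn-injective a _ _

-- Distinct representatives

module _ {n : ℕ} where

  AtLeastTwo : (Fin n → Set) → Set
  AtLeastTwo F = ∀ x → ∃ λ j → j ≢ x × F j

  record Transversal (F₁ F₂ F₃ : Fin n → Set) : Set where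
    constructor transversal
    field
      {x₁ x₂ x₃} : Fin n
      x₁≢x₂ : x₁ ≢ x₂
      x₁≢x₃ : x₁ ≢ x₃
      x₂≢x₃ : x₂ ≢ x₃
      F₁x₁  : F₁ x₁
      F₂x₂  : F₂ x₂
      F₃x₃  : F₃ x₃

  record SharedPair (F₁ F₂ F₃ : Fin n → Set) : Set where
    constructor sharedPair
    field
      {a b}     : Fin n
      a≢b       : a ≢ b
      F₁a       : F₁ a
      F₁b       : F₁ b
      F₂a       : F₂ a
      F₂b       : F₂ b
      F₃a       : F₃ a
      F₃-within : ¬ (∃ λ j → j ≢ a × j ≢ b × F₃ j)

confined-to-pair : ∀ {n} {F : Fin n → Set} {x y} → AtLeastTwo F →
  ¬ (∃ λ j → j ≢ x × j ≢ y × F j) → F x × F y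
confined-to-pair {F = F} {x} {y} two outside = at-x , at-y
  where
  at-x : F x
  at-x with j , j≢y , Fj ← two y with j ≟ x
  ... | yes refl = Fj
  ... | no  j≢x  = contradiction (j , j≢x , j≢y , Fj) outside
  at-y : F y
  at-y with j , j≢x , Fj ← two x with j ≟ y
  ... | yes refl = Fj
  ... | no  j≢y  = contradiction (j , j≢x , j≢y , Fj) outside

transversal-or-sharedPair : ∀ {n} {F₁ F₂ F₃ : Fin (suc n) → Set} →
  Decidable F₁ → Decidable F₂ → Decidable F₃ →
  AtLeastTwo F₁ → AtLeastTwo F₂ → AtLeastTwo F₃ →
  Transversal F₁ F₂ F₃ ⊎ SharedPair F₁ F₂ F₃
transversal-or-sharedPair F₁? F₂? F₃? two₁ two₂ two₃
  with x₁ , _ , F₁x₁ ← two₁ zero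
  with x₂ , x₂≢x₁ , F₂x₂ ← two₂ x₁
  with any? (λ j → ¬? (j ≟ x₁) ×-dec ¬? (j ≟ x₂) ×-dec F₃? j)
... | yes (x₃ , x₃≢x₁ , x₃≢x₂ , F₃x₃) =
  inj₁ (transversal (≢-sym x₂≢x₁) (≢-sym x₃≢x₁) (≢-sym x₃≢x₂) F₁x₁ F₂x₂ F₃x₃)
... | no outside with F₁? x₂ | F₂? x₁ | confined-to-pair two₃ outside
...   | no ¬F₁x₂ | _ | F₃x₁ , _ with r , r≢x₁ , F₁r ← two₁ x₁ =
  inj₁ (transversal (λ { refl → ¬F₁x₂ F₁r }) r≢x₁ x₂≢x₁ F₁r F₂x₂ F₃x₁)
...   | yes _ | no ¬F₂x₁ | _ , F₃x₂ with r , r≢x₂ , F₂r ← two₂ x₂ =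
  inj₁ (transversal (λ { refl → ¬F₂x₁ F₂r }) (≢-sym x₂≢x₁) r≢x₂ F₁x₁ F₂r F₃x₂)
...   | yes F₁x₂ | yes F₂x₁ | F₃x₁ , _ =
  inj₂ (sharedPair (≢-sym x₂≢x₁) F₁x₁ F₁x₂ F₂x₁ F₂x₂ F₃x₁ outside)

any-Vec-Bool? : ∀ {n ℓ} {P : Pred (Vec Bool n) ℓ} → Decidable P → Dec (∃ P)
any-Vec-Bool? {zero}  P? = map′ ([] ,_) (λ { ([] , p) → p }) (P? [])
any-Vec-Bool? {suc n} {P = P} P? =
  map′ from to (any-Vec-Bool? (P? ∘ (true ∷_)) ⊎-dec any-Vec-Bool? (P? ∘ (false ∷_)))
  where
  from : ∃ (P ∘ (true ∷_)) ⊎ ∃ (P ∘ (false ∷_)) → ∃ P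
  from (inj₁ (v , p)) = true ∷ v , p
  from (inj₂ (v , p)) = false ∷ v , p
  to : ∃ P → ∃ (P ∘ (true ∷_)) ⊎ ∃ (P ∘ (false ∷_))
  to (true  ∷ v , p) = inj₁ (v , p)
  to (false ∷ v , p) = inj₂ (v , p)

module _ {d : ℕ} (φ : PartialColoring d) where

  Occurs : Color d → Fin d → Set
  Occurs c j = ∃ λ e → dir e ≡ j × φ e ≡ just c

  Free : Color d → Fin d → Set
  Free c j = ¬ Occurs c j

  occurs? : ∀ c j → Dec (Occurs c j)
  occurs? c j = map′ (λ (v , p , φe) → edge v j p , refl , φe)
                     (λ { (edge v _ p , refl , φe) → v , p , φe })
                     (any-Vec-Bool? low-of-coloured?)
    where
    low-of-coloured? : ∀ v → Dec (Σ (lookup v j ≡ false) λ p → φ (edge v j p) ≡ just c)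
    low-of-coloured? v with lookup v j ≟ᵇ false
    ... | no  vⱼ≢false = no (vⱼ≢false ∘ proj₁)
    ... | yes vⱼ≡false = map′ (vⱼ≡false ,_) (λ (_ , φe) → trans (cong φ (edge-≡ refl refl)) φe)
                              (Maybe.≡-dec _≟_ (φ (edge v j vⱼ≡false)) (just c))

  free? : ∀ c j → Dec (Free c j)
  free? c j = ¬? (occurs? c j)

  ColoursAmong : Color d → Color d → Color d → Set
  ColoursAmong c₁ c₂ c₃ = ∀ e c → φ e ≡ just c → c ≡ c₁ ⊎ c ≡ c₂ ⊎ c ≡ c₃

module _ {d m : ℕ} {φ : PartialColoring d} {c : Color d} (bound : ColorOnAtMost m φ c) where

  coloured-family-bound : ∀ {n} (w : Fin n → Edge d) → Injective _≡_ _≡_ w →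
    (∀ i → φ (w i) ≡ just c) → n ≤ m
  coloured-family-bound w w-injective coloured = subst (_≤ m) (length-tabulate w)
    (bound (tabulate w) (Unique.tabulate⁺ w-injective) (All.tabulate⁺ coloured))

  coloured-family-bound⁺ : ∀ {n} (e : Edge d) (w : Fin n → Edge d) → Injective _≡_ _≡_ w →
    φ e ≡ just c → (∀ i → φ (w i) ≡ just c) → (∀ i → e ≢ w i) → suc n ≤ m
  coloured-family-bound⁺ e w w-injective φe coloured e∉w = subst (λ n → suc n ≤ m) (length-tabulate w)
    (bound (e ∷ tabulate w) (All.tabulate⁺ e∉w ∷ Unique.tabulate⁺ w-injective)
           (φe ∷ All.tabulate⁺ coloured))

free-in-two-directions : ∀ {n} {φ : PartialColoring (suc (suc n))} {c} → ColorOnAtMost n φ c →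
  AtLeastTwo (Free φ c)
free-in-two-directions {n} {φ} {c} bound x with any? (λ j → ¬? (j ≟ x) ×-dec free? φ c j)
... | yes found = found
... | no  none  = contradiction (coloured-family-bound bound w w-injective (proj₂ ∘ proj₂ ∘ witness)) 1+n≰n
  where
  witness : ∀ i → Occurs φ c (punchIn x i)
  witness i = decidable-stable (occurs? φ c _) (λ free → none (punchIn x i , punchInᵢ≢i x i , free))
  w : Fin (suc n) → Edge _
  w = proj₁ ∘ witness
  w-injective : Injective _≡_ _≡_ w
  w-injective {i} {j} wᵢ≡wⱼ = punchIn-injective x i j
    (trans (sym (proj₁ (proj₂ (witness i)))) (trans (cong dir wᵢ≡wⱼ) (proj₁ (proj₂ (witness j)))))

-- c already has an edge in each of the d - 2 directions other than a and b, and it has at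
-- most d - 2 edges in all.
occurs-once : ∀ {m} {φ : PartialColoring (suc (suc (suc m)))} {c a b} → ColorOnAtMost (suc m) φ c →
  a ≢ b → (∀ j → j ≢ a → j ≢ b → Occurs φ c j) →
  ∀ e e′ → dir e ≡ dir e′ → φ e ≡ just c → φ e′ ≡ just c → e ≡ e′
occurs-once {m} {φ} {c} bound a≢b occurs e e′ dir≡ φe φe′ with e ≟ₑ e′
... | yes e≡e′ = e≡e′
... | no  e≢e′ = contradiction (coloured-family-bound⁺ bound e w w-injective φe w-coloured e∉w) 1+n≰n
  where
  g : Fin (suc m) → Fin _
  g = punchIn₂ a≢b
  pick : ∀ i → ∃ λ z → dir z ≡ g i × φ z ≡ just c × e ≢ z
  pick i with g i ≟ dir e
  ... | yes gᵢ≡dir = e′ , trans (sym dir≡) (sym gᵢ≡dir) , φe′ , e≢e′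
  ... | no  gᵢ≢dir with z , dir-z , φz ← occurs (g i) (punchIn₂≢ˡ a≢b i) (punchIn₂≢ʳ a≢b i) =
    z , dir-z , φz , λ { refl → gᵢ≢dir (sym dir-z) }
  w : Fin (suc m) → Edge _
  w = proj₁ ∘ pick
  w-injective : Injective _≡_ _≡_ w
  w-injective {i} {j} wᵢ≡wⱼ = punchIn₂-injective a≢b
    (trans (sym (proj₁ (proj₂ (pick i)))) (trans (cong dir wᵢ≡wⱼ) (proj₁ (proj₂ (pick j)))))
  w-coloured : ∀ i → φ (w i) ≡ just c
  w-coloured = proj₁ ∘ proj₂ ∘ proj₂ ∘ pick
  e∉w : ∀ i → e ≢ w i
  e∉w = proj₂ ∘ proj₂ ∘ proj₂ ∘ pick

-- Colourings by direction, possibly switched on one square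

proper-by-direction : ∀ {d} (π : Fin d → Color d) → Injective _≡_ _≡_ π → Proper (π ∘ dir)
proper-by-direction π π-injective =
  proper-from-local-injections (λ _ → π) (λ _ → π-injective) (λ _ _ → refl)

avoidable-by-transversal : ∀ {d} {φ : PartialColoring d} {c₁ c₂ c₃} →
  c₁ ≢ c₂ → c₁ ≢ c₃ → c₂ ≢ c₃ → ColoursAmong φ c₁ c₂ c₃ →
  Transversal (Free φ c₁) (Free φ c₂) (Free φ c₃) → Avoidable φ
avoidable-by-transversal {φ = φ} {c₁} {c₂} {c₃} c₁≢c₂ c₁≢c₃ c₂≢c₃ among
  (transversal {x₁} {x₂} {x₃} x₁≢x₂ x₁≢x₃ x₂≢x₃ free₁ free₂ free₃)
  with π , π-injective , πx₁ , πx₂ , πx₃ ← injection₃ x₁≢x₂ x₁≢x₃ x₂≢x₃ c₁≢c₂ c₁≢c₃ c₂≢c₃ =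
  π ∘ dir , proper-by-direction π π-injective , avoids
  where
  avoids : ∀ e c → φ e ≡ just c → π (dir e) ≢ c
  avoids e c φe πe≡c with among e c φe
  ... | inj₁ refl        = free₁ (e , π-injective (trans πe≡c (sym πx₁)) , φe)
  ... | inj₂ (inj₁ refl) = free₂ (e , π-injective (trans πe≡c (sym πx₂)) , φe)
  ... | inj₂ (inj₂ refl) = free₃ (e , π-injective (trans πe≡c (sym πx₃)) , φe)

-- Starting from π ∘ dir, exchange the colours of directions a and k on the 2-face through w₀
-- spanned by a and k; a vertex v lies on that face iff collapse v ≡ collapse w₀.
module SquareSwitch {d : ℕ} (π : Fin d → Color d) (π-injective : Injective _≡_ _≡_ π)
                    {a k : Fin d} (a≢k : a ≢ k) (w₀ : Vertex d) where

  collapse : Vertex d → Vertex d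
  collapse v = v [ a ]≔ false [ k ]≔ false

  InSquare : Vertex d → Set
  InSquare v = collapse v ≡ collapse w₀

  inSquare? : ∀ v → Dec (InSquare v)
  inSquare? v = Vec.≡-dec _≟ᵇ_ (collapse v) (collapse w₀)

  switchIf : ∀ {P : Set} → Dec P → Fin d → Fin d
  switchIf (yes _) = transpose a k
  switchIf (no _)  = id

  σ : Vertex d → Fin d → Color d
  σ v = π ∘ switchIf (inSquare? v)

  switched : Edge d → Color d
  switched e = σ (low e) (dir e)

  collapse-flip : ∀ v {j} → j ≡ a ⊎ j ≡ k → collapse (flip v j) ≡ collapse v
  collapse-flip v (inj₁ refl) = cong (_[ k ]≔ false) (updateAt-updateAt a v)
  collapse-flip v (inj₂ refl) = begin
    flip v k [ a ]≔ false [ k ]≔ false  ≡⟨ cong (_[ k ]≔ false) (updateAt-commutes a k a≢k v) ⟩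
    flip (v [ a ]≔ false) k [ k ]≔ false ≡⟨ updateAt-updateAt k (v [ a ]≔ false) ⟩
    collapse v                          ∎
    where open ≡-Reasoning

  σ-injective : ∀ v → Injective _≡_ _≡_ (σ v)
  σ-injective v with inSquare? v
  ... | yes _ = transpose-injective a k ∘ π-injective
  ... | no _  = π-injective

  σ-flip : ∀ v j → σ (flip v j) j ≡ σ v j
  σ-flip v j with j ≟ a | j ≟ k
  ... | yes j≡a | _       rewrite collapse-flip v (inj₁ j≡a) = refl
  ... | no _    | yes j≡k rewrite collapse-flip v (inj₂ j≡k) = refl
  ... | no j≢a  | no j≢k  = cong π (trans (fixed (inSquare? (flip v j))) (sym (fixed (inSquare? v))))
    where
    fixed : ∀ {P : Set} (p : Dec P) → switchIf p j ≡ j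
    fixed (yes _) = transpose-fix a k j≢a j≢k
    fixed (no _)  = refl

  switched-proper : Proper switched
  switched-proper = proper-from-local-injections σ σ-injective σ-flip

  agrees-off-square : ∀ {v i} → InSquare v → i ≢ a → i ≢ k → lookup v i ≡ lookup w₀ i
  agrees-off-square {v} {i} same i≢a i≢k = begin
    lookup v i           ≡⟨ lookup-collapse v ⟨
    lookup (collapse v)  i ≡⟨ cong (λ u → lookup u i) same ⟩
    lookup (collapse w₀) i ≡⟨ lookup-collapse w₀ ⟩
    lookup w₀ i          ∎
    where
    open ≡-Reasoning
    lookup-collapse : ∀ u → lookup (collapse u) i ≡ lookup u i
    lookup-collapse u = trans (lookup∘updateAt′ i k {const false} i≢k (u [ a ]≔ false))
                              (lookup∘updateAt′ i a {const false} i≢a u)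

  agree-everywhere : ∀ {u v : Vertex d} → lookup u a ≡ lookup v a → lookup u k ≡ lookup v k →
    (∀ {i} → i ≢ a → i ≢ k → lookup u i ≡ lookup v i) → u ≡ v
  agree-everywhere {u} {v} atₐ atₖ off = Pointwise-≡⇒≡ (ext agree)
    where
    agree : ∀ i → lookup u i ≡ lookup v i
    agree i with i ≟ a | i ≟ k
    ... | yes refl | _        = atₐ
    ... | no _     | yes refl = atₖ
    ... | no i≢a   | no i≢k   = off i≢a i≢k

  square-low : ∀ {v} → lookup w₀ k ≡ false → lookup v k ≡ false → InSquare v →
    v ≡ w₀ ⊎ v ≡ flip w₀ a
  square-low {v} w₀ₖ vₖ same with lookup v a ≟ᵇ lookup w₀ a
  ... | yes vₐ≡ = inj₁ (agree-everywhere vₐ≡ (trans vₖ (sym w₀ₖ)) (agrees-off-square same))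
  ... | no  vₐ≢ = inj₂ (agree-everywhere (trans (¬-not vₐ≢) (sym (lookup∘updateAt a w₀)))
                                         (trans vₖ (sym (trans (lookup-flip-other w₀ (≢-sym a≢k)) w₀ₖ)))
                                         (λ i≢a i≢k → trans (agrees-off-square same i≢a i≢k)
                                                           (sym (lookup-flip-other w₀ i≢a))))

-- Colour directions a, b and k = dir e₀ by c₁, c₂ and c₃, then switch on the square through e₀
-- spanned by a and k. Outside the square no edge of direction k has colour c₃, as e₀ is the only
-- one; inside, colour c₁ lands on e₀ (coloured c₃) and on its translate (not coloured c₁).
avoidable-by-square-switch : ∀ {d} {φ : PartialColoring d} {c₁ c₂ c₃ : Color d} {a b : Fin d} →
  c₁ ≢ c₂ → c₁ ≢ c₃ → c₂ ≢ c₃ → a ≢ b → ColoursAmong φ c₁ c₂ c₃ →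
  (e₀ : Edge d) (k≢a : dir e₀ ≢ a) → dir e₀ ≢ b → φ e₀ ≡ just c₃ →
  (∀ e → dir e ≡ dir e₀ → φ e ≡ just c₃ → e ≡ e₀) → φ (shift e₀ a k≢a) ≢ just c₁ →
  Free φ c₁ a → Free φ c₂ b → Free φ c₃ a → Avoidable φ
avoidable-by-square-switch {φ = φ} {c₁} {c₂} {c₃} {a} {b} c₁≢c₂ c₁≢c₃ c₂≢c₃ a≢b among
  e₀ k≢a k≢b φe₀ unique φe₀′≢c₁ free₁ free₂ free₃
  with π , π-injective , πa , πb , πk ← injection₃ a≢b (≢-sym k≢a) (≢-sym k≢b) c₁≢c₂ c₁≢c₃ c₂≢c₃ =
  switched , switched-proper , avoids
  where
  k : Fin _
  k = dir e₀
  open SquareSwitch π π-injective (≢-sym k≢a) (low e₀)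

  untranspose : ∀ {y x} → π (transpose a k y) ≡ π x → y ≡ transpose k a x
  untranspose eq = trans (sym (transpose-inverse k a)) (cong (transpose k a) (π-injective eq))

  avoids : ∀ e c → φ e ≡ just c → switched e ≢ c
  avoids e c φe with inSquare? (low e) | among e c φe
  ... | yes inside | inj₁ refl = λ same →
    let dir≡k = trans (untranspose (trans same (sym πa))) (transpose-matchʳ k a) in
    case square-low (low-i e₀) (trans (cong (lookup (low e)) (sym dir≡k)) (low-i e)) inside of λ where
      (inj₁ low≡) → c₁≢c₃ (Maybe.just-injective
                       (trans (sym φe) (trans (cong φ (edge-≡ low≡ dir≡k)) φe₀)))
      (inj₂ low≡) → φe₀′≢c₁ (trans (cong φ (sym (edge-≡ low≡ dir≡k))) φe)
  ... | yes _ | inj₂ (inj₁ refl) = λ same →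
    free₂ (e , trans (untranspose (trans same (sym πb))) (transpose-fix k a (≢-sym k≢b) (≢-sym a≢b)) , φe)
  ... | yes _ | inj₂ (inj₂ refl) = λ same →
    free₃ (e , trans (untranspose (trans same (sym πk))) (transpose-matchˡ k a) , φe)
  ... | no _ | inj₁ refl        = λ same → free₁ (e , π-injective (trans same (sym πa)) , φe)
  ... | no _ | inj₂ (inj₁ refl) = λ same → free₂ (e , π-injective (trans same (sym πb)) , φe)
  ... | no outside | inj₂ (inj₂ refl) = λ same →
    outside (cong (collapse ∘ low) (unique e (π-injective (trans same (sym πk))) φe))

avoidable-by-sharedPair : ∀ {m} {φ : PartialColoring (suc (suc (suc m)))} {c₁ c₂ c₃} →
  c₁ ≢ c₂ → c₁ ≢ c₃ → c₂ ≢ c₃ → ColoursAmong φ c₁ c₂ c₃ → ColorOnAtMost (suc m) φ c₃ →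
  SharedPair (Free φ c₁) (Free φ c₂) (Free φ c₃) → Avoidable φ
avoidable-by-sharedPair {φ = φ} {c₁} {c₂} {c₃} c₁≢c₂ c₁≢c₃ c₂≢c₃ among bound₃
  (sharedPair {a} {b} a≢b free₁a free₁b free₂a free₂b free₃a within) =
  switch (Maybe.≡-dec _≟_ (φ (shift e₀ a k≢a)) (just c₁))
  where
  occurs₃ : ∀ j → j ≢ a → j ≢ b → Occurs φ c₃ j
  occurs₃ j j≢a j≢b = decidable-stable (occurs? φ c₃ j) (λ free → within (j , j≢a , j≢b , free))

  k : Fin _
  k = punchIn₂ a≢b zero
  e₀-occurs : Occurs φ c₃ k
  e₀-occurs = occurs₃ k (punchIn₂≢ˡ a≢b zero) (punchIn₂≢ʳ a≢b zero)
  e₀ : Edge _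
  e₀ = proj₁ e₀-occurs
  φe₀ : φ e₀ ≡ just c₃
  φe₀ = proj₂ (proj₂ e₀-occurs)
  k≢a : dir e₀ ≢ a
  k≢a rewrite proj₁ (proj₂ e₀-occurs) = punchIn₂≢ˡ a≢b zero
  k≢b : dir e₀ ≢ b
  k≢b rewrite proj₁ (proj₂ e₀-occurs) = punchIn₂≢ʳ a≢b zero

  unique : ∀ e → dir e ≡ dir e₀ → φ e ≡ just c₃ → e ≡ e₀
  unique e dir≡ φe = occurs-once bound₃ a≢b occurs₃ e e₀ dir≡ φe φe₀

  among₂₁₃ : ColoursAmong φ c₂ c₁ c₃
  among₂₁₃ e c φe with among e c φe
  ... | inj₁ c≡c₁        = inj₂ (inj₁ c≡c₁)
  ... | inj₂ (inj₁ c≡c₂) = inj₁ c≡c₂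
  ... | inj₂ (inj₂ c≡c₃) = inj₂ (inj₂ c≡c₃)

  -- The colour of the edge parallel to e₀ decides which of c₁, c₂ goes to direction a.
  switch : Dec (φ (shift e₀ a k≢a) ≡ just c₁) → Avoidable φ
  switch (no φe₀′≢c₁) = avoidable-by-square-switch c₁≢c₂ c₁≢c₃ c₂≢c₃ a≢b among
    e₀ k≢a k≢b φe₀ unique φe₀′≢c₁ free₁a free₂b free₃a
  switch (yes φe₀′≡c₁) = avoidable-by-square-switch (≢-sym c₁≢c₂) c₂≢c₃ c₁≢c₃ a≢b among₂₁₃
    e₀ k≢a k≢b φe₀ unique (c₁≢c₂ ∘ Maybe.just-injective ∘ trans (sym φe₀′≡c₁)) free₂a free₁b free₃a

avoidable-three-colours : ∀ {m} {φ : PartialColoring (suc (suc (suc m)))} {c₁ c₂ c₃} →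
  c₁ ≢ c₂ → c₁ ≢ c₃ → c₂ ≢ c₃ → ColoursAmong φ c₁ c₂ c₃ →
  (∀ c → ColorOnAtMost (suc m) φ c) → Avoidable φ
avoidable-three-colours {φ = φ} {c₁} {c₂} {c₃} c₁≢c₂ c₁≢c₃ c₂≢c₃ among bound =
  [ avoidable-by-transversal c₁≢c₂ c₁≢c₃ c₂≢c₃ among
  , avoidable-by-sharedPair c₁≢c₂ c₁≢c₃ c₂≢c₃ among (bound c₃) ]′
  (transversal-or-sharedPair {F₁ = Free φ c₁} {Free φ c₂} {Free φ c₃}
    (free? φ c₁) (free? φ c₂) (free? φ c₃)
    (free-in-two-directions (bound c₁)) (free-in-two-directions (bound c₂)) (free-in-two-directions (bound c₃)))

avoidable-if-uncoloured : ∀ {d} {φ : PartialColoring d} → (∀ c → ColorOnAtMost 0 φ c) → Avoidable φ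
avoidable-if-uncoloured bound =
  dir , proper-by-direction id id , λ e c φe _ → contradiction (bound c (e ∷ []) ([] ∷ []) (φe ∷ [])) λ ()

-- Padding to three distinct colours

record DistinctCover {n : ℕ} (P : Fin n → Set) : Set where
  constructor distinctCover
  field
    {c₁ c₂ c₃} : Fin n
    c₁≢c₂  : c₁ ≢ c₂
    c₁≢c₃  : c₁ ≢ c₃
    c₂≢c₃  : c₂ ≢ c₃
    covers : ∀ {x} → P x → x ≡ c₁ ⊎ x ≡ c₂ ⊎ x ≡ c₃

restrict : ∀ {n} {P Q : Fin n → Set} → DistinctCover P → Q ⊆ P → DistinctCover Q
restrict (distinctCover c₁≢c₂ c₁≢c₃ c₂≢c₃ covers) Q⊆P = distinctCover c₁≢c₂ c₁≢c₃ c₂≢c₃ (covers ∘ Q⊆P)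

module _ {m : ℕ} where

  cover-pair : (u v : Fin (suc (suc (suc m)))) → DistinctCover (λ x → x ≡ u ⊎ x ≡ v)
  cover-pair u v with u ≟ v
  ... | yes refl = distinctCover u≢w (≢-sym (punchIn₂≢ˡ u≢w zero)) (≢-sym (punchIn₂≢ʳ u≢w zero))
                     λ where (inj₁ x≡u) → inj₁ x≡u
                             (inj₂ x≡u) → inj₁ x≡u
    where
    u≢w : u ≢ punchIn u zero
    u≢w = ≢-sym (punchInᵢ≢i u zero)
  ... | no u≢v = distinctCover u≢v (≢-sym (punchIn₂≢ˡ u≢v zero)) (≢-sym (punchIn₂≢ʳ u≢v zero))
                   λ where (inj₁ x≡u) → inj₁ x≡u
                           (inj₂ x≡v) → inj₂ (inj₁ x≡v)

  cover-triple : (u v w : Fin (suc (suc (suc m)))) → DistinctCover (λ x → x ≡ u ⊎ x ≡ v ⊎ x ≡ w)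
  cover-triple u v w with w ≟ u | w ≟ v | u ≟ v
  ... | yes refl | _ | _ = restrict (cover-pair u v) λ where
    (inj₁ x≡u)        → inj₁ x≡u
    (inj₂ (inj₁ x≡v)) → inj₂ x≡v
    (inj₂ (inj₂ x≡u)) → inj₁ x≡u
  ... | no _ | yes refl | _ = restrict (cover-pair u v) λ where
    (inj₁ x≡u)        → inj₁ x≡u
    (inj₂ (inj₁ x≡v)) → inj₂ x≡v
    (inj₂ (inj₂ x≡v)) → inj₂ x≡v
  ... | no _ | no _ | yes refl = restrict (cover-pair u w) λ where
    (inj₁ x≡u)        → inj₁ x≡u
    (inj₂ (inj₁ x≡u)) → inj₁ x≡u
    (inj₂ (inj₂ x≡w)) → inj₂ x≡w
  ... | no w≢u | no w≢v | no u≢v = distinctCover u≢v (≢-sym w≢u) (≢-sym w≢v) id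

  cover-list : (cs : List (Fin (suc (suc (suc m))))) → length cs ≤ 3 → DistinctCover (_∈ cs)
  cover-list [] _ = restrict (cover-pair zero zero) λ ()
  cover-list (u ∷ []) _ = restrict (cover-pair u u) λ where (here x≡u) → inj₁ x≡u
  cover-list (u ∷ v ∷ []) _ = restrict (cover-pair u v) λ where
    (here x≡u)         → inj₁ x≡u
    (there (here x≡v)) → inj₂ x≡v
  cover-list (u ∷ v ∷ w ∷ []) _ = restrict (cover-triple u v w) λ where
    (here x≡u)                 → inj₁ x≡u
    (there (here x≡v))         → inj₂ (inj₁ x≡v)
    (there (there (here x≡w))) → inj₂ (inj₂ x≡w)
  cover-list (_ ∷ _ ∷ _ ∷ _ ∷ _) (s≤s (s≤s (s≤s ())))

proposition3p7 : (d : ℕ) (φ : PartialColoring d) →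
    UsesAtMostColors 3 φ →
    (∀ (c : Color d) → ColorOnAtMost (d ∸ 2) φ c) →
    Avoidable φ
proposition3p7 zero                _ _ bound = avoidable-if-uncoloured bound
proposition3p7 (suc zero)          _ _ bound = avoidable-if-uncoloured bound
proposition3p7 (suc (suc zero))    _ _ bound = avoidable-if-uncoloured bound
proposition3p7 (suc (suc (suc m))) φ (cs , |cs|≤3 , uses) bound
  with distinctCover c₁≢c₂ c₁≢c₃ c₂≢c₃ covers ← cover-list cs |cs|≤3 =
  avoidable-three-colours c₁≢c₂ c₁≢c₃ c₂≢c₃ (λ e c φe → covers (uses e c φe)) bound
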